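{- For any may-must argumentation $F$, $\Gamma[F]\neq\emptyset$ (there exists a concretisation of $F$), and for any abstract dialectical framework $G$, $\Delta[G]\neq\emptyset$ (there exists an abstraction of $G$).
   Context: Labels: $\mathcal{L}=\{\mathsf{in},\mathsf{out},\mathsf{undec}\}$. For a finite set $S$ of arguments, $\Lambda^S$ is the set of total functions $S\to\mathcal{L}$. A nuance tuple is $((n_1,n_2),(m_1,m_2))\in\mathbb{N}^4$ with $n_1\le n_2$, $m_1\le m_2$. A may-must argumentation (MMA) is $(A,R,f_Q)$ with $A$ finite, $R\subseteq A\times A$, $f_Q$ assigning a nuance tuple to each argument. $\mathrm{pre}(a)=\{b\in A:(b,a)\in R\}$. For $\lambda$ a labelling, $o_\lambda(a)$ (resp. $i_\lambda(a)$) is the number of $b\in\mathrm{pre}(a)$ with $\lambda(b)=\mathsf{out}$ (resp. $\mathsf{in}$). With $f_Q(a)=((n_1,n_2),(m_1,m_2))$: may-a iff $n_1\le o_\lambda(a)$; must-a iff $n_2\le o_\lambda(a)$; may$_s$-a iff $n_1\le o_\lambda(a)<n_2$; not-a iff $o_\lambda(a)<n_1$; may-r, must-r, may$_s$-r, not-r likewise with $m_1,m_2,i_\lambda(a)$. $\lambda$ designates $l$ for $a$ in the MMA iff $\lambda$ is defined on all of $\mathrm{pre}(a)$ and: $l=\mathsf{in}$ requires may-a and not must-r; $l=\mathsf{out}$ requires may-r and not must-a; $l=\mathsf{undec}$ requires (must-a and must-r) or may$_s$-a or may$_s$-r or (not-a and not-r). An abstract dialectical framework (ADF) is $(A,R,C)$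 with $C=(C_a)_{a\in A}$, $C_a:\Lambda^{\mathrm{pre}(a)}\to\mathcal{L}$. $\Gamma[F]$ (concretisations of an MMA $F=(A,R,f_Q)$): all ADFs $(A,R,C)$ with, for every $a\in A$ and $\lambda\in\Lambda^{\mathrm{pre}(a)}$, $\lambda$ designating $C_a(\lambda)$ for $a$ in $F$. $\Delta[G]$ (abstractions of an ADF $G=(A,R,C)$): all MMAs $(A,R,f_Q)$ such that for every $a\in A$, with $f_Q(a)=((n_1,n_2),(m_1,m_2))$, $n_2\le|\mathrm{pre}(a)|+1$, $m_2\le|\mathrm{pre}(a)|+1$, and for every $\lambda\in\Lambda^{\mathrm{pre}(a)}$, $\lambda$ designates $C_a(\lambda)$ for $a$ in $(A,R,f_Q)$ (explicitly, with $o=o_\lambda(a),i=i_\lambda(a)$: $o<n_1,i<m_1\Rightarrow C_a(\lambda)=\mathsf{undec}$; $n_1\le o<n_2,i<m_1\Rightarrow C_a(\lambda)\in\{\mathsf{in},\mathsf{undec}\}$; $n_2\le o,i<m_1\Rightarrow\mathsf{in}$; $o<n_1,m_1\le i<m_2\Rightarrow\{\mathsf{out},\mathsf{undec}\}$; $n_1\le o<n_2,m_1\le i<m_2\Rightarrow$ any; $n_2\le o,m_1\le i<m_2\Rightarrow\{\mathsf{in},\mathsf{undec}\}$; $o<n_1,m_2\le i\Rightarrow\mathsf{out}$; $n_1\le o<n_2,m_2\le i\Rightarrow\{\mathsf{out},\mathsf{undec}\}$; $n_2\le o,m_2\le i\Rightarrow\mathsf{undec}$). -}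

module Defs where

open import Data.Nat using (ℕ; zero; suc; _+_; _≤_; _<_)
open import Data.Fin using (Fin; zero; suc)
open import Data.Bool using (Bool; true; false; T)
open import Data.Unit using (tt)
open import Data.Product using (_×_; Σ; _,_)
open import Data.Sum using (_⊎_)
open import Relation.Nullary using (¬_)
open import Relation.Binary.PropositionalEquality using (_≡_)

data Label : Set where
  lin lout lundec : Label

-- Arguments are Fin n (a finite set); the attack relation R ⊆ A × A is
-- given by its (decidable) characteristic function: R b a = true iff (b,a) ∈ R.
Rel : ℕ → Set
Rel n = Fin n → Fin n → Bool

-- Λ^{pre(a)} : total labellings of pre(a) = { b | (b,a) ∈ R }
PreLab : {n : ℕ} → Rel n → Fin n → Set
PreLab {n} R a = (b : Fin n) → T (R b a) → Label

sumFin : (n : ℕ) → (Fin n → ℕ) → ℕ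
sumFin zero f = 0
sumFin (suc n) f = f zero + sumFin n (λ i → f (suc i))

isLabel : Label → Label → ℕ
isLabel lin lin = 1
isLabel lout lout = 1
isLabel lundec lundec = 1
isLabel _ _ = 0

countAt : Label → (r : Bool) → (T r → Label) → ℕ
countAt l true f = isLabel (f tt) l
countAt l false f = 0

outCount : {n : ℕ} (R : Rel n) (a : Fin n) → PreLab R a → ℕ
outCount {n} R a lam = sumFin n (λ b → countAt lout (R b a) (lam b))

inCount : {n : ℕ} (R : Rel n) (a : Fin n) → PreLab R a → ℕ
inCount {n} R a lam = sumFin n (λ b → countAt lin (R b a) (lam b))

bit : Bool → ℕ
bit true = 1
bit false = 0

preSize : {n : ℕ} (R : Rel n) (a : Fin n) → ℕ
preSize {n} R a = sumFin n (λ b → bit (R b a))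

record Nuance : Set where
  constructor nuance
  field
    n1 n2 m1 m2 : ℕ
    n1≤n2 : n1 ≤ n2
    m1≤m2 : m1 ≤ m2
open Nuance public

record MMA : Set where
  constructor mma
  field
    size : ℕ
    att  : Rel size
    fQ   : Fin size → Nuance

record ADF : Set where
  constructor adf
  field
    size : ℕ
    att  : Rel size
    cond : (a : Fin size) → PreLab att a → Label

module _ (q : Nuance) (o i : ℕ) where
  may-a must-a mays-a not-a may-r must-r mays-r not-r : Set
  may-a  = n1 q ≤ o
  must-a = n2 q ≤ o
  mays-a = (n1 q ≤ o) × (o < n2 q)
  not-a  = o < n1 q
  may-r  = m1 q ≤ i
  must-r = m2 q ≤ i
  mays-r = (m1 q ≤ i) × (i < m2 q)
  not-r  = i < m1 q

  DesignatesQ : Label → Set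
  DesignatesQ lin    = may-a × ¬ must-r
  DesignatesQ lout   = may-r × ¬ must-a
  DesignatesQ lundec = (must-a × must-r) ⊎ mays-a ⊎ mays-r ⊎ (not-a × not-r)

Designates : {n : ℕ} (R : Rel n) (fQ : Fin n → Nuance) (a : Fin n) →
             PreLab R a → Label → Set
Designates R fQ a lam l = DesignatesQ (fQ a) (outCount R a lam) (inCount R a lam) l

IsConcretisationCond : (F : MMA) → ((a : Fin (MMA.size F)) → PreLab (MMA.att F) a → Label) → Set
IsConcretisationCond F C =
  (a : Fin (MMA.size F)) (lam : PreLab (MMA.att F) a) →
  Designates (MMA.att F) (MMA.fQ F) a lam (C a lam)

IsAbstractionFQ : (G : ADF) → (Fin (ADF.size G) → Nuance) → Set
IsAbstractionFQ G fQ =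
  (a : Fin (ADF.size G)) →
    (n2 (fQ a) ≤ suc (preSize (ADF.att G) a)) ×
    (m2 (fQ a) ≤ suc (preSize (ADF.att G) a)) ×
    ((lam : PreLab (ADF.att G) a) → Designates (ADF.att G) fQ a lam (ADF.cond G a lam))

GammaNonEmpty : MMA → Set
GammaNonEmpty F = Σ ((a : Fin (MMA.size F)) → PreLab (MMA.att F) a → Label) (IsConcretisationCond F)

DeltaNonEmpty : ADF → Set
DeltaNonEmpty G = Σ (Fin (ADF.size G) → Nuance) (IsAbstractionFQ G)

-- Every pair of counts (o, i) designates some label: the conditions for in, out and
-- undec are exhaustive once n₁ ≤ n₂ and m₁ ≤ m₂, which gives a concretisation of any
-- MMA. Conversely, o_λ(a) and i_λ(a) never exceed |pre(a)|, so the nuance tuple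
-- ((0, |pre(a)| + 1), (0, |pre(a)| + 1)) lets every λ designate every label, and
-- hence abstracts any ADF.
module Submission where

open import Defs
open import Data.Product using (_×_; Σ; _,_; proj₁; proj₂)
open import Data.Sum using (inj₁; inj₂)
open import Data.Nat using (ℕ; suc; _≤_; z≤n; s≤s; _≤?_)
open import Data.Nat.Properties using (≤-refl; ≤-trans; ≰⇒>; ≤⇒≯; +-mono-≤)
open import Data.Fin using (Fin; zero; suc)
open import Data.Bool using (Bool; true; false; T)
open import Data.Unit using (tt)
open import Relation.Nullary using (yes; no; contradiction)

designatesQ-total : (q : Nuance) (o i : ℕ) → Σ Label (DesignatesQ q o i)
designatesQ-total q o i with n1 q ≤? o | m2 q ≤? i | m1 q ≤? i | n2 q ≤? o
... | yes may-a  | no ¬must-r | _         | _          = lin , may-a , ¬must-r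
... | _          | _          | yes may-r | no ¬must-a = lout , may-r , ¬must-a
... | no ¬may-a  | _          | no ¬may-r | _          =
  lundec , inj₂ (inj₂ (inj₂ (≰⇒> ¬may-a , ≰⇒> ¬may-r)))
... | yes _      | yes must-r | _         | yes must-a = lundec , inj₁ (must-a , must-r)
... | no ¬may-a  | _          | yes _     | yes must-a =
  contradiction (≤-trans (n1≤n2 q) must-a) ¬may-a
... | yes _      | yes must-r | no ¬may-r | _          =
  contradiction (≤-trans (m1≤m2 q) must-r) ¬may-r

gammaNonEmpty : (F : MMA) → GammaNonEmpty F
gammaNonEmpty (mma n R fQ) =
    (λ a lam → proj₁ (choice a lam))
  , (λ a lam → proj₂ (choice a lam))
  where
  choice : (a : Fin n) (lam : PreLab R a) →
           Σ Label (Designates R fQ a lam)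
  choice a lam = designatesQ-total (fQ a) (outCount R a lam) (inCount R a lam)

permissiveNuance : ℕ → Nuance
permissiveNuance k = nuance 0 (suc k) 0 (suc k) z≤n z≤n

permissiveNuance-designates : ∀ {k o i} → o ≤ k → i ≤ k →
                              (l : Label) → DesignatesQ (permissiveNuance k) o i l
permissiveNuance-designates o≤k i≤k lin    = z≤n , ≤⇒≯ i≤k
permissiveNuance-designates o≤k i≤k lout   = z≤n , ≤⇒≯ o≤k
permissiveNuance-designates o≤k i≤k lundec = inj₂ (inj₁ (z≤n , s≤s o≤k))

isLabel≤1 : (x l : Label) → isLabel x l ≤ 1
isLabel≤1 lin    lin    = ≤-refl
isLabel≤1 lin    lout   = z≤n
isLabel≤1 lin    lundec = z≤n
isLabel≤1 lout   lin    = z≤n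
isLabel≤1 lout   lout   = ≤-refl
isLabel≤1 lout   lundec = z≤n
isLabel≤1 lundec lin    = z≤n
isLabel≤1 lundec lout   = z≤n
isLabel≤1 lundec lundec = ≤-refl

countAt≤bit : (l : Label) (r : Bool) (f : T r → Label) → countAt l r f ≤ bit r
countAt≤bit l true  f = isLabel≤1 (f tt) l
countAt≤bit l false f = z≤n

sumFin-mono-≤ : (n : ℕ) {f g : Fin n → ℕ} →
                (∀ b → f b ≤ g b) → sumFin n f ≤ sumFin n g
sumFin-mono-≤ ℕ.zero    f≤g = z≤n
sumFin-mono-≤ (ℕ.suc n) f≤g = +-mono-≤ (f≤g zero) (sumFin-mono-≤ n (λ b → f≤g (suc b)))

labelCount≤preSize : {n : ℕ} (R : Rel n) (a : Fin n) (lam : PreLab R a) (l : Label) →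
                     sumFin n (λ b → countAt l (R b a) (lam b)) ≤ preSize R a
labelCount≤preSize {n} R a lam l = sumFin-mono-≤ n (λ b → countAt≤bit l (R b a) (lam b))

deltaNonEmpty : (G : ADF) → DeltaNonEmpty G
deltaNonEmpty (adf n R C) = fQ , λ a → ≤-refl , ≤-refl , λ lam →
  permissiveNuance-designates (labelCount≤preSize R a lam lout)
                              (labelCount≤preSize R a lam lin) (C a lam)
  where
  fQ : Fin n → Nuance
  fQ a = permissiveNuance (preSize R a)

mainTheorem4 : ((F : MMA) → GammaNonEmpty F) × ((G : ADF) → DeltaNonEmpty G)
mainTheorem4 = gammaNonEmpty , deltaNonEmpty
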